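{- Let $K_3^{ - }$ be the $2$-colored graph on vertex set $\{1,2,3\}$ with red edges $\{12,13,23\}$ and blue edges $\{12,13\}$. Then $\pi(K_3^{ - })=\frac{3}{2}$.
   Context: A $2$-colored graph is $G=(V,E_r,E_b)$ with $E_r,E_b\subseteq\binom{V}{2}$ (not necessarily disjoint). $G$ is $H$-free if it contains no sub-graph isomorphic to $H$ (red edges into red, blue edges into blue). For $G$ on $n$ vertices $h_n(G)=(|E_r(G)|+|E_b(G)|)/\binom{n}{2}$, and $\pi(H)=\lim_{n\to\infty}\max h_n(G_n)$ over $H$-free $2$-colored graphs $G_n$ on $n$ vertices. -}

module Defs where

open import Data.Bool using (Bool; true; false; if_then_else_; _∧_)
open import Data.Nat using (ℕ; zero; suc; _<ᵇ_)
open import Data.Nat.Combinatorics using (_C_)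
open import Data.Fin using (Fin; toℕ; zero; suc)
open import Data.List using (List; map; allFin)
open import Data.Nat.ListAction using (sum)
open import Data.Integer using (+_)
open import Data.Rational using (ℚ; _/_; 0ℚ)
open import Data.Product using (Σ; ∃; _×_)
open import Function.Definitions using (Injective)
open import Relation.Binary.PropositionalEquality using (_≡_)
open import Relation.Nullary using (¬_)

-- A 2-colored graph on vertex set Fin n: red and blue edge relations,
-- symmetric (edges are unordered pairs; the diagonal is ignored).
-- Red and blue edge sets need not be disjoint.
record TwoColoredGraph (n : ℕ) : Set where
  field
    red  : Fin n → Fin n → Bool
    blue : Fin n → Fin n → Bool
    red-sym  : ∀ i j → red i j ≡ red j i
    blue-sym : ∀ i j → blue i j ≡ blue j i
open TwoColoredGraph public

edgeCount : {n : ℕ} → (Fin n → Fin n → Bool) → ℕ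
edgeCount {n} e =
  sum (map (λ i → sum (map (λ j → if (toℕ i <ᵇ toℕ j) ∧ e i j then 1 else 0)
                            (allFin n)))
           (allFin n))

ContainsCopy : {k n : ℕ} → TwoColoredGraph k → TwoColoredGraph n → Set
ContainsCopy {k} {n} H G =
  Σ (Fin k → Fin n) λ f →
    Injective _≡_ _≡_ f
    × (∀ i j → red H i j ≡ true → red G (f i) (f j) ≡ true)
    × (∀ i j → blue H i j ≡ true → blue G (f i) (f j) ≡ true)

Free : {k n : ℕ} → TwoColoredGraph k → TwoColoredGraph n → Set
Free H G = ¬ ContainsCopy H G

-- h_n(G) = (|E_r| + |E_b|) / binom(n,2)   (set to 0 when binom(n,2) = 0, i.e. n < 2)
density : {n : ℕ} → TwoColoredGraph n → ℚ
density {n} G with n C 2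
... | zero  = 0ℚ
... | suc m = (+ (edgeCount (red G) Data.Nat.+ edgeCount (blue G))) / suc m

-- K_3^- on {1,2,3} = Fin 3 (vertex 1 ↦ 0, 2 ↦ 1, 3 ↦ 2):
-- red edges 12,13,23 ; blue edges 12,13.
k3red : Fin 3 → Fin 3 → Bool
k3red zero zero = false
k3red (suc zero) (suc zero) = false
k3red (suc (suc zero)) (suc (suc zero)) = false
k3red _ _ = true

k3blue : Fin 3 → Fin 3 → Bool
k3blue zero (suc _) = true
k3blue (suc _) zero = true
k3blue _ _ = false

k3red-sym : ∀ i j → k3red i j ≡ k3red j i
k3red-sym zero zero = _≡_.refl
k3red-sym zero (suc zero) = _≡_.refl
k3red-sym zero (suc (suc zero)) = _≡_.refl
k3red-sym (suc zero) zero = _≡_.refl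
k3red-sym (suc zero) (suc zero) = _≡_.refl
k3red-sym (suc zero) (suc (suc zero)) = _≡_.refl
k3red-sym (suc (suc zero)) zero = _≡_.refl
k3red-sym (suc (suc zero)) (suc zero) = _≡_.refl
k3red-sym (suc (suc zero)) (suc (suc zero)) = _≡_.refl

k3blue-sym : ∀ i j → k3blue i j ≡ k3blue j i
k3blue-sym zero zero = _≡_.refl
k3blue-sym zero (suc _) = _≡_.refl
k3blue-sym (suc _) zero = _≡_.refl
k3blue-sym (suc _) (suc _) = _≡_.refl

K3⁻ : TwoColoredGraph 3
K3⁻ = record { red = k3red ; blue = k3blue ; red-sym = k3red-sym ; blue-sym = k3blue-sym }

threeHalves : ℚ
threeHalves = + 3 / 2

{-# OPTIONS --safe #-}

-- Upper bound: a pair counted twice is both red and blue, and these doubled edges form a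
-- triangle-free graph, since a doubled triangle is a copy of K₃⁻.  By Mantel's theorem there are
-- at most n²/4 of them, so |E_r| + |E_b| ≤ C(n,2) + n²/4, a density of 3/2 + 1/(2(n-1)).
-- Mantel is proved by double counting: adjacent vertices have degree sum at most n, whence
-- Σ d(v)² ≤ n·|E|, and AM-GM in the form 4n·d ≤ 4d² + n² turns this into 4|E| ≤ n².
-- Lower bound: make every pair blue and the pairs of opposite parity red.  The red graph is
-- bipartite, so triangle-free, and contains at least half of all pairs: density ≥ 3/2.

module Submission where

open import Defs

module EdgeCounting where
  open import Data.Bool using (Bool; true; false; if_then_else_; not; _∧_; _xor_)
  open import Data.Bool.Properties using (xor-comm; not-involutive)
  open import Data.Empty using (⊥; ⊥-elim)
  open import Data.Fin using (Fin; zero; suc; toℕ)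
  open import Data.Fin.Properties using () renaming (_≟_ to _≟ᶠ_)
  open import Data.List using (map; tabulate; allFin)
  open import Data.List.Properties using (map-tabulate)
  open import Data.Nat using (ℕ; zero; suc; _+_; _*_; _∸_; _≤_; _<_; _<ᵇ_; _≡ᵇ_; z≤n; s≤s; NonZero)
  open import Data.Nat.Combinatorics using (_C_; nC1≡n; nCk+nC[k+1]≡[n+1]C[k+1])
  open import Data.Nat.ListAction using () renaming (sum to listSum)
  open import Data.Nat.Properties
  open import Data.Nat.Tactic.RingSolver using (solve-∀)
  open import Algebra.Properties.Semiring.Sum +-*-semiring
    using (sum; sum-syntax; sum-cong-≗; ∑-distrib-+; ∑-comm; *-distribˡ-sum; *-distribʳ-sum)
  open import Data.Product using (_×_; _,_; proj₁; proj₂)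
  open import Data.Sum using (inj₁; inj₂)
  open import Function using (_∘_; id)
  open import Function.Definitions using (Injective)
  open import Relation.Binary.PropositionalEquality
  open import Relation.Nullary using (yes; no)

  -- Stated with if_then_else_ so that it is definitionally the summand of edgeCount.
  ⟦_⟧ : Bool → ℕ
  ⟦ b ⟧ = if b then 1 else 0

  ⟦⟧≤1 : ∀ b → ⟦ b ⟧ ≤ 1
  ⟦⟧≤1 true = s≤s z≤n
  ⟦⟧≤1 false = z≤n

  ⟦⟧*-monoʳ-≤ : ∀ b {x y} → (b ≡ true → x ≤ y) → ⟦ b ⟧ * x ≤ ⟦ b ⟧ * y
  ⟦⟧*-monoʳ-≤ true x≤y = *-monoʳ-≤ 1 (x≤y refl)
  ⟦⟧*-monoʳ-≤ false _ = z≤n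

  sum-mono-≤ : ∀ {n} {f g : Fin n → ℕ} → (∀ i → f i ≤ g i) → sum f ≤ sum g
  sum-mono-≤ {zero} f≤g = z≤n
  sum-mono-≤ {suc n} f≤g = +-mono-≤ (f≤g zero) (sum-mono-≤ (f≤g ∘ suc))

  sum-const : ∀ n c → ∑[ i < n ] c ≡ n * c
  sum-const zero c = refl
  sum-const (suc n) c = cong (c +_) (sum-const n c)

  ∑∑-distrib-+ : ∀ {m n} (f g : Fin m → Fin n → ℕ) →
    ∑[ i < m ] ∑[ j < n ] (f i j + g i j) ≡ ∑[ i < m ] ∑[ j < n ] f i j + ∑[ i < m ] ∑[ j < n ] g i j
  ∑∑-distrib-+ {m} {n} f g =
    trans (sum-cong-≗ (λ i → ∑-distrib-+ {n} (f i) (g i))) (∑-distrib-+ {m} _ _)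

  listSum-tabulate : ∀ {n} (f : Fin n → ℕ) → listSum (tabulate f) ≡ sum f
  listSum-tabulate {zero} f = refl
  listSum-tabulate {suc n} f = cong (f zero +_) (listSum-tabulate (f ∘ suc))

  listSum-allFin : ∀ {n} (f : Fin n → ℕ) → listSum (map f (allFin n)) ≡ sum f
  listSum-allFin f = trans (cong listSum (map-tabulate id f)) (listSum-tabulate f)

  ∧-true⁻ : ∀ {x y} → x ∧ y ≡ true → x ≡ true × y ≡ true
  ∧-true⁻ {true} {true} _ = refl , refl

  ≡ᵇ-refl : ∀ m → (m ≡ᵇ m) ≡ true
  ≡ᵇ-refl zero = refl
  ≡ᵇ-refl (suc m) = ≡ᵇ-refl m

  ≡ᵇ-sym : ∀ m n → (m ≡ᵇ n) ≡ (n ≡ᵇ m)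
  ≡ᵇ-sym zero zero = refl
  ≡ᵇ-sym zero (suc n) = refl
  ≡ᵇ-sym (suc m) zero = refl
  ≡ᵇ-sym (suc m) (suc n) = ≡ᵇ-sym m n

  <ᵇ-+-<ᵇ : ∀ m n x → ⟦ (m <ᵇ n) ∧ x ⟧ + ⟦ (n <ᵇ m) ∧ x ⟧ ≡ ⟦ not (m ≡ᵇ n) ∧ x ⟧
  <ᵇ-+-<ᵇ zero zero x = refl
  <ᵇ-+-<ᵇ zero (suc n) false = refl
  <ᵇ-+-<ᵇ zero (suc n) true = refl
  <ᵇ-+-<ᵇ (suc m) zero false = refl
  <ᵇ-+-<ᵇ (suc m) zero true = refl
  <ᵇ-+-<ᵇ (suc m) (suc n) x = <ᵇ-+-<ᵇ m n x

  C2-suc : ∀ n → suc n C 2 ≡ n + n C 2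
  C2-suc n = trans (sym (nCk+nC[k+1]≡[n+1]C[k+1] n 1)) (cong (_+ n C 2) (nC1≡n n))

  C2-double : ∀ n → 2 * (n C 2) + n ≡ n * n
  C2-double zero = refl
  C2-double (suc n) = begin
    2 * (suc n C 2) + suc n          ≡⟨ cong (λ c → 2 * c + suc n) (C2-suc n) ⟩
    2 * (n + n C 2) + suc n          ≡⟨ regroup n (n C 2) ⟩
    suc (n + n + (2 * (n C 2) + n))  ≡⟨ cong (λ m → suc (n + n + m)) (C2-double n) ⟩
    suc (n + n + n * n)              ≡⟨ square-suc n ⟩
    suc n * suc n                    ∎
    where
    open ≡-Reasoning
    regroup : ∀ n c → 2 * (n + c) + suc n ≡ suc (n + n + (2 * c + n))
    regroup = solve-∀
    square-suc : ∀ n → suc (n + n + n * n) ≡ suc n * suc n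
    square-suc = solve-∀

  C2-pos : ∀ {n} → 2 ≤ n → 0 < n C 2
  C2-pos {suc zero} (s≤s ())
  C2-pos {suc (suc k)} _ = subst (0 <_) (sym (C2-suc (suc k))) (s≤s z≤n)

  Adjacency : ℕ → Set
  Adjacency n = Fin n → Fin n → Bool

  IsSymmetric : ∀ {n} → Adjacency n → Set
  IsSymmetric e = ∀ i j → e i j ≡ e j i

  edgeCount-∑ : ∀ {n} (e : Adjacency n) →
    edgeCount e ≡ ∑[ i < n ] ∑[ j < n ] ⟦ (toℕ i <ᵇ toℕ j) ∧ e i j ⟧
  edgeCount-∑ {n} e =
    trans (listSum-allFin {n} _) (sum-cong-≗ {n} (λ i → listSum-allFin (λ j → ⟦ (toℕ i <ᵇ toℕ j) ∧ e i j ⟧)))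

  edgeCount-cong : ∀ {n} {e e′ : Adjacency n} → (∀ i j → e i j ≡ e′ i j) → edgeCount e ≡ edgeCount e′
  edgeCount-cong {e = e} {e′} e≗e′ = begin
    edgeCount e                                          ≡⟨ edgeCount-∑ e ⟩
    ∑[ i < _ ] ∑[ j < _ ] ⟦ (toℕ i <ᵇ toℕ j) ∧ e i j ⟧  ≡⟨ sum-cong-≗ (λ i → sum-cong-≗ (λ j →
                                                             cong (λ b → ⟦ (toℕ i <ᵇ toℕ j) ∧ b ⟧) (e≗e′ i j))) ⟩
    ∑[ i < _ ] ∑[ j < _ ] ⟦ (toℕ i <ᵇ toℕ j) ∧ e′ i j ⟧ ≡⟨ edgeCount-∑ e′ ⟨
    edgeCount e′                                         ∎
    where open ≡-Reasoning

  edgeCount-suc : ∀ {n} (e : Adjacency (suc n)) →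
    edgeCount e ≡ ∑[ j < n ] ⟦ e zero (suc j) ⟧ + edgeCount (λ i j → e (suc i) (suc j))
  edgeCount-suc {n} e =
    trans (edgeCount-∑ e) (cong (∑[ j < n ] ⟦ e zero (suc j) ⟧ +_) (sym (edgeCount-∑ {n} _)))

  edgeCount-complete : ∀ n → edgeCount {n} (λ _ _ → true) ≡ n C 2
  edgeCount-complete zero = refl
  edgeCount-complete (suc n) = begin
    edgeCount {suc n} (λ _ _ → true)             ≡⟨ edgeCount-suc {n} (λ _ _ → true) ⟩
    ∑[ j < n ] 1 + edgeCount {n} (λ _ _ → true)  ≡⟨ cong₂ _+_ (sum-const n 1) (edgeCount-complete n) ⟩
    n * 1 + n C 2                                ≡⟨ cong (_+ n C 2) (*-identityʳ n) ⟩
    n + n C 2                                    ≡⟨ C2-suc n ⟨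
    suc n C 2                                    ∎
    where open ≡-Reasoning

  edgeCount-+-≤ : ∀ {n} (r b : Adjacency n) →
    edgeCount r + edgeCount b ≤ n C 2 + edgeCount (λ i j → r i j ∧ b i j)
  edgeCount-+-≤ {n} r b = begin
    edgeCount r + edgeCount b
      ≡⟨ cong₂ _+_ (edgeCount-∑ r) (edgeCount-∑ b) ⟩
    ∑[ i < n ] ∑[ j < n ] ⟦ i ≺ j ∧ r i j ⟧ + ∑[ i < n ] ∑[ j < n ] ⟦ i ≺ j ∧ b i j ⟧
      ≡⟨ ∑∑-distrib-+ {n} {n} _ _ ⟨
    ∑[ i < n ] ∑[ j < n ] (⟦ i ≺ j ∧ r i j ⟧ + ⟦ i ≺ j ∧ b i j ⟧)
      ≤⟨ sum-mono-≤ (λ i → sum-mono-≤ (λ j → inclusion-exclusion (i ≺ j) (r i j) (b i j))) ⟩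
    ∑[ i < n ] ∑[ j < n ] (⟦ i ≺ j ∧ true ⟧ + ⟦ i ≺ j ∧ (r i j ∧ b i j) ⟧)
      ≡⟨ ∑∑-distrib-+ {n} {n} _ _ ⟩
    ∑[ i < n ] ∑[ j < n ] ⟦ i ≺ j ∧ true ⟧ + ∑[ i < n ] ∑[ j < n ] ⟦ i ≺ j ∧ (r i j ∧ b i j) ⟧
      ≡⟨ cong₂ _+_ (trans (sym (edgeCount-complete n)) (edgeCount-∑ {n} _)) (edgeCount-∑ {n} _) ⟨
    n C 2 + edgeCount (λ i j → r i j ∧ b i j) ∎
    where
    open ≤-Reasoning
    _≺_ : Fin n → Fin n → Bool
    i ≺ j = toℕ i <ᵇ toℕ j
    inclusion-exclusion : ∀ l x y → ⟦ l ∧ x ⟧ + ⟦ l ∧ y ⟧ ≤ ⟦ l ∧ true ⟧ + ⟦ l ∧ (x ∧ y) ⟧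
    inclusion-exclusion false x y = z≤n
    inclusion-exclusion true false y = ⟦⟧≤1 y
    inclusion-exclusion true true false = s≤s z≤n
    inclusion-exclusion true true true = ≤-refl

  amgm-ordered : ∀ a c → 2 * (a * (a + c)) ≤ a * a + (a + c) * (a + c)
  amgm-ordered a c = ≤-trans (m≤m+n _ (c * c)) (≤-reflexive (square-expansion a c))
    where
    square-expansion : ∀ a c → 2 * (a * (a + c)) + c * c ≡ a * a + (a + c) * (a + c)
    square-expansion = solve-∀

  amgm : ∀ a b → 2 * (a * b) ≤ a * a + b * b
  amgm a b with ≤-total a b
  ... | inj₁ a≤b = subst (λ b → 2 * (a * b) ≤ a * a + b * b) (m+[n∸m]≡n a≤b) (amgm-ordered a (b ∸ a))
  ... | inj₂ b≤a = subst₂ _≤_ (cong (2 *_) (*-comm b a)) (+-comm (b * b) (a * a))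
    (subst (λ a → 2 * (b * a) ≤ b * b + a * a) (m+[n∸m]≡n b≤a) (amgm-ordered b (a ∸ b)))

  amgm-scaled : ∀ n x → 4 * n * x ≤ 4 * (x * x) + n * n
  amgm-scaled n x = subst₂ _≤_ (lhs n x) (rhs n x) (amgm (2 * x) n)
    where
    lhs : ∀ n x → 2 * (2 * x * n) ≡ 4 * n * x
    lhs = solve-∀
    rhs : ∀ n x → 2 * x * (2 * x) + n * n ≡ 4 * (x * x) + n * n
    rhs = solve-∀

  mantel-arithmetic : ∀ n P Q .{{_ : NonZero n}} →
    4 * n * P ≤ 4 * Q + n * (n * n) → 2 * Q ≤ n * P → 2 * P ≤ n * n
  mantel-arithmetic n P Q amgm-sum degree²-sum = *-cancelˡ-≤ n (+-cancelʳ-≤ (2 * (n * P)) _ _ (begin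
    n * (2 * P) + 2 * (n * P)   ≡⟨ regroup n P ⟩
    4 * n * P                   ≤⟨ amgm-sum ⟩
    4 * Q + n * (n * n)         ≡⟨ +-comm (4 * Q) _ ⟩
    n * (n * n) + 4 * Q         ≡⟨ cong (n * (n * n) +_) (double-double Q) ⟩
    n * (n * n) + 2 * (2 * Q)   ≤⟨ +-monoʳ-≤ (n * (n * n)) (*-monoʳ-≤ 2 degree²-sum) ⟩
    n * (n * n) + 2 * (n * P)   ∎))
    where
    open ≤-Reasoning
    regroup : ∀ n P → n * (2 * P) + 2 * (n * P) ≡ 4 * n * P
    regroup = solve-∀
    double-double : ∀ Q → 4 * Q ≡ 2 * (2 * Q)
    double-double = solve-∀

  module _ {n : ℕ} (e : Adjacency n) where

    -- The relations of a TwoColoredGraph are unconstrained on the diagonal, which adjacency ignores.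
    adjacent : Adjacency n
    adjacent i j = not (toℕ i ≡ᵇ toℕ j) ∧ e i j

    degree : Fin n → ℕ
    degree i = ∑[ j < n ] ⟦ adjacent i j ⟧

    TriangleFree : Set
    TriangleFree = ∀ u v w → adjacent u v ≡ true → adjacent u w ≡ true → adjacent v w ≡ true → ⊥

    adjacent⇒≢ : ∀ {i j} → adjacent i j ≡ true → i ≢ j
    adjacent⇒≢ {i} adj refl with () ← trans (sym adj) (cong (λ b → not b ∧ e i i) (≡ᵇ-refl (toℕ i)))

    adjacent⇒edge : ∀ {i j} → adjacent i j ≡ true → e i j ≡ true
    adjacent⇒edge = proj₂ ∘ ∧-true⁻

    module _ (e-sym : IsSymmetric e) where

      adjacent-sym : IsSymmetric adjacent
      adjacent-sym i j = cong₂ (λ b x → not b ∧ x) (≡ᵇ-sym (toℕ i) (toℕ j)) (e-sym i j)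

      handshake : edgeCount e + edgeCount e ≡ sum degree
      handshake = begin
        edgeCount e + edgeCount e
          ≡⟨ cong₂ _+_ (edgeCount-∑ e) transposed ⟩
        ∑[ i < n ] ∑[ j < n ] ⟦ (toℕ i <ᵇ toℕ j) ∧ e i j ⟧ + ∑[ i < n ] ∑[ j < n ] ⟦ (toℕ j <ᵇ toℕ i) ∧ e i j ⟧
          ≡⟨ ∑∑-distrib-+ {n} {n} _ _ ⟨
        ∑[ i < n ] ∑[ j < n ] (⟦ (toℕ i <ᵇ toℕ j) ∧ e i j ⟧ + ⟦ (toℕ j <ᵇ toℕ i) ∧ e i j ⟧)
          ≡⟨ sum-cong-≗ (λ i → sum-cong-≗ (λ j → <ᵇ-+-<ᵇ (toℕ i) (toℕ j) (e i j))) ⟩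
        sum degree ∎
        where
        open ≡-Reasoning
        transposed : edgeCount e ≡ ∑[ i < n ] ∑[ j < n ] ⟦ (toℕ j <ᵇ toℕ i) ∧ e i j ⟧
        transposed = begin
          edgeCount e                                        ≡⟨ edgeCount-∑ e ⟩
          ∑[ j < n ] ∑[ i < n ] ⟦ (toℕ j <ᵇ toℕ i) ∧ e j i ⟧ ≡⟨ ∑-comm {n} {n} _ ⟩
          ∑[ i < n ] ∑[ j < n ] ⟦ (toℕ j <ᵇ toℕ i) ∧ e j i ⟧ ≡⟨ sum-cong-≗ (λ i → sum-cong-≗ (λ j →
                                                                  cong (λ b → ⟦ (toℕ j <ᵇ toℕ i) ∧ b ⟧) (e-sym j i))) ⟩
          ∑[ i < n ] ∑[ j < n ] ⟦ (toℕ j <ᵇ toℕ i) ∧ e i j ⟧ ∎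

      module _ (triangle-free : TriangleFree) where

        degree-+-degree-≤ : ∀ {u v} → adjacent u v ≡ true → degree u + degree v ≤ n
        degree-+-degree-≤ {u} {v} uv = begin
          degree u + degree v                            ≡⟨ ∑-distrib-+ {n} _ _ ⟨
          ∑[ w < n ] (⟦ adjacent u w ⟧ + ⟦ adjacent v w ⟧) ≤⟨ sum-mono-≤ common-neighbour ⟩
          ∑[ w < n ] 1                                   ≡⟨ sum-const n 1 ⟩
          n * 1                                          ≡⟨ *-identityʳ n ⟩
          n                                              ∎
          where
          open ≤-Reasoning
          common-neighbour : ∀ w → ⟦ adjacent u w ⟧ + ⟦ adjacent v w ⟧ ≤ 1
          common-neighbour w with adjacent u w in uw | adjacent v w in vw
          ... | true  | true  = ⊥-elim (triangle-free u v w uv uw vw)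
          ... | true  | false = ≤-refl
          ... | false | b     = ⟦⟧≤1 b

        sum-degree²-≤ : 2 * ∑[ v < n ] (degree v * degree v) ≤ n * sum degree
        sum-degree²-≤ = begin
          2 * Q                                               ≡⟨ cong (Q +_) (+-identityʳ Q) ⟩
          Q + Q                                               ≡⟨ cong₂ _+_ Q-by-left Q-by-right ⟩
          ∑[ v < n ] ∑[ u < n ] (⟦ adjacent v u ⟧ * degree v)
            + ∑[ v < n ] ∑[ u < n ] (⟦ adjacent v u ⟧ * degree u) ≡⟨ ∑∑-distrib-+ {n} {n} _ _ ⟨
          ∑[ v < n ] ∑[ u < n ] (⟦ adjacent v u ⟧ * degree v + ⟦ adjacent v u ⟧ * degree u)
                                                              ≤⟨ sum-mono-≤ (λ v → sum-mono-≤ (edge-term v)) ⟩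
          ∑[ v < n ] ∑[ u < n ] (⟦ adjacent v u ⟧ * n)        ≡⟨ sum-cong-≗ (λ v → *-distribʳ-sum n (λ u → ⟦ adjacent v u ⟧)) ⟨
          ∑[ v < n ] (degree v * n)                           ≡⟨ *-distribʳ-sum n degree ⟨
          sum degree * n                                      ≡⟨ *-comm (sum degree) n ⟩
          n * sum degree                                      ∎
          where
          open ≤-Reasoning
          Q : ℕ
          Q = ∑[ v < n ] (degree v * degree v)
          Q-by-left : Q ≡ ∑[ v < n ] ∑[ u < n ] (⟦ adjacent v u ⟧ * degree v)
          Q-by-left = sum-cong-≗ (λ v → *-distribʳ-sum (degree v) (λ u → ⟦ adjacent v u ⟧))
          Q-by-right : Q ≡ ∑[ v < n ] ∑[ u < n ] (⟦ adjacent v u ⟧ * degree u)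
          Q-by-right = trans Q-by-left (trans (∑-comm {n} {n} _)
            (sum-cong-≗ (λ v → sum-cong-≗ (λ u → cong (λ b → ⟦ b ⟧ * degree u) (adjacent-sym u v)))))
          edge-term : ∀ v u → ⟦ adjacent v u ⟧ * degree v + ⟦ adjacent v u ⟧ * degree u ≤ ⟦ adjacent v u ⟧ * n
          edge-term v u = ≤-trans (≤-reflexive (sym (*-distribˡ-+ ⟦ adjacent v u ⟧ (degree v) (degree u))))
                                  (⟦⟧*-monoʳ-≤ (adjacent v u) degree-+-degree-≤)

        sum-degree-amgm : 4 * n * sum degree ≤ 4 * ∑[ v < n ] (degree v * degree v) + n * (n * n)
        sum-degree-amgm = begin
          4 * n * sum degree                                   ≡⟨ *-distribˡ-sum (4 * n) degree ⟩
          ∑[ v < n ] (4 * n * degree v)                        ≤⟨ sum-mono-≤ (λ v → amgm-scaled n (degree v)) ⟩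
          ∑[ v < n ] (4 * (degree v * degree v) + n * n)       ≡⟨ ∑-distrib-+ {n} _ _ ⟩
          ∑[ v < n ] (4 * (degree v * degree v)) + ∑[ v < n ] (n * n)
                                                               ≡⟨ cong₂ _+_ (sym (*-distribˡ-sum 4 (λ v → degree v * degree v))) (sum-const n (n * n)) ⟩
          4 * ∑[ v < n ] (degree v * degree v) + n * (n * n)   ∎
          where open ≤-Reasoning

  mantel : ∀ {n} (e : Adjacency n) → IsSymmetric e → TriangleFree e → 4 * edgeCount e ≤ n * n
  mantel {zero} e _ _ = z≤n
  mantel {n@(suc _)} e e-sym triangle-free = begin
    4 * edgeCount e                   ≡⟨ quadruple (edgeCount e) ⟩
    2 * (edgeCount e + edgeCount e)   ≡⟨ cong (2 *_) (handshake e e-sym) ⟩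
    2 * sum (degree e)                ≤⟨ mantel-arithmetic n (sum (degree e)) (∑[ v < n ] (degree e v * degree e v))
                                           (sum-degree-amgm e e-sym triangle-free) (sum-degree²-≤ e e-sym triangle-free) ⟩
    n * n                             ∎
    where
    open ≤-Reasoning
    quadruple : ∀ x → 4 * x ≡ 2 * (x + x)
    quadruple = solve-∀

  doubleEdges : ∀ {n} → TwoColoredGraph n → Adjacency n
  doubleEdges G i j = red G i j ∧ blue G i j

  doubleEdges-sym : ∀ {n} (G : TwoColoredGraph n) → IsSymmetric (doubleEdges G)
  doubleEdges-sym G i j = cong₂ _∧_ (red-sym G i j) (blue-sym G i j)

  k3red-irrefl : ∀ i → k3red i i ≢ true
  k3red-irrefl zero ()
  k3red-irrefl (suc zero) ()
  k3red-irrefl (suc (suc zero)) ()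

  k3blue-irrefl : ∀ i → k3blue i i ≢ true
  k3blue-irrefl zero ()
  k3blue-irrefl (suc _) ()

  K3⁻-copy : ∀ {n} (G : TwoColoredGraph n) (f : Fin 3 → Fin n) →
    (∀ i j → i ≢ j → adjacent (doubleEdges G) (f i) (f j) ≡ true) → ContainsCopy K3⁻ G
  K3⁻-copy G f distinct⇒adjacent = f , injective , preserves-red , preserves-blue
    where
    double : ∀ {i j} → i ≢ j → red G (f i) (f j) ≡ true × blue G (f i) (f j) ≡ true
    double i≢j = ∧-true⁻ (adjacent⇒edge (doubleEdges G) (distinct⇒adjacent _ _ i≢j))
    injective : Injective _≡_ _≡_ f
    injective {i} {j} fi≡fj with i ≟ᶠ j
    ... | yes i≡j = i≡j
    ... | no i≢j = ⊥-elim (adjacent⇒≢ (doubleEdges G) (distinct⇒adjacent i j i≢j) fi≡fj)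
    preserves-red : ∀ i j → k3red i j ≡ true → red G (f i) (f j) ≡ true
    preserves-red i j ij = proj₁ (double λ { refl → k3red-irrefl i ij })
    preserves-blue : ∀ i j → k3blue i j ≡ true → blue G (f i) (f j) ≡ true
    preserves-blue i j ij = proj₂ (double λ { refl → k3blue-irrefl i ij })

  K3⁻-free⇒triangleFree : ∀ {n} (G : TwoColoredGraph n) → Free K3⁻ G → TriangleFree (doubleEdges G)
  K3⁻-free⇒triangleFree {n} G free u v w uv uw vw = free (K3⁻-copy G triangle distinct⇒adjacent)
    where
    triangle : Fin 3 → Fin n
    triangle zero = u
    triangle (suc zero) = v
    triangle (suc (suc zero)) = w
    flip : ∀ x y → adjacent (doubleEdges G) x y ≡ true → adjacent (doubleEdges G) y x ≡ true
    flip x y xy = trans (adjacent-sym (doubleEdges G) (doubleEdges-sym G) y x) xy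
    distinct⇒adjacent : ∀ i j → i ≢ j → adjacent (doubleEdges G) (triangle i) (triangle j) ≡ true
    distinct⇒adjacent zero (suc zero) _ = uv
    distinct⇒adjacent zero (suc (suc zero)) _ = uw
    distinct⇒adjacent (suc zero) (suc (suc zero)) _ = vw
    distinct⇒adjacent (suc zero) zero _ = flip u v uv
    distinct⇒adjacent (suc (suc zero)) zero _ = flip u w uw
    distinct⇒adjacent (suc (suc zero)) (suc zero) _ = flip v w vw
    distinct⇒adjacent zero zero i≢i = ⊥-elim (i≢i refl)
    distinct⇒adjacent (suc zero) (suc zero) i≢i = ⊥-elim (i≢i refl)
    distinct⇒adjacent (suc (suc zero)) (suc (suc zero)) i≢i = ⊥-elim (i≢i refl)

  edges : ∀ {n} → TwoColoredGraph n → ℕ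
  edges G = edgeCount (red G) + edgeCount (blue G)

  K3⁻-free-edges-≤ : ∀ {n} (G : TwoColoredGraph n) → Free K3⁻ G → 4 * edges G ≤ 6 * (n C 2) + n
  K3⁻-free-edges-≤ {n} G free = begin
    4 * edges G                                  ≤⟨ *-monoʳ-≤ 4 (edgeCount-+-≤ (red G) (blue G)) ⟩
    4 * (n C 2 + edgeCount (doubleEdges G))      ≡⟨ *-distribˡ-+ 4 (n C 2) _ ⟩
    4 * (n C 2) + 4 * edgeCount (doubleEdges G)  ≤⟨ +-monoʳ-≤ (4 * (n C 2)) (mantel (doubleEdges G) (doubleEdges-sym G)
                                                      (K3⁻-free⇒triangleFree G free)) ⟩
    4 * (n C 2) + n * n                          ≡⟨ cong (4 * (n C 2) +_) (C2-double n) ⟨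
    4 * (n C 2) + (2 * (n C 2) + n)              ≡⟨ regroup (n C 2) n ⟩
    6 * (n C 2) + n                              ∎
    where
    open ≤-Reasoning
    regroup : ∀ c n → 4 * c + (2 * c + n) ≡ 6 * c + n
    regroup = solve-∀

  -- W / c ≤ 3/2 + (p+1)/(d+1) cross-multiplied, when c = n(n-1)/2 and n ≥ d + 2.
  threeHalves-slack : ∀ {n c} W d p → 2 + d ≤ n → 2 * c + n ≡ n * n → 4 * W ≤ 6 * c + n →
    W * (2 * suc d) ≤ (3 * suc d + suc p * 2) * c
  threeHalves-slack {suc k} {c} W d p (s≤s d<k) c-identity W-bound = *-cancelˡ-≤ 2 (begin
    2 * (W * (2 * suc d))              ≡⟨ regroup₁ W (suc d) ⟩
    4 * W * suc d                      ≤⟨ *-monoˡ-≤ (suc d) W-bound ⟩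
    (6 * c + suc k) * suc d            ≡⟨ *-distribʳ-+ (suc d) (6 * c) (suc k) ⟩
    6 * c * suc d + suc k * suc d      ≤⟨ +-monoʳ-≤ (6 * c * suc d) (*-monoʳ-≤ (suc k) d<k) ⟩
    6 * c * suc d + suc k * k          ≡⟨ cong (6 * c * suc d +_) 2c≡n[n-1] ⟨
    6 * c * suc d + 2 * c              ≤⟨ +-monoʳ-≤ (6 * c * suc d) (*-monoˡ-≤ c 2≤4[p+1]) ⟩
    6 * c * suc d + 4 * suc p * c      ≡⟨ regroup₂ c (suc d) (suc p) ⟩
    2 * ((3 * suc d + suc p * 2) * c)  ∎)
    where
    open ≤-Reasoning
    2c≡n[n-1] : 2 * c ≡ suc k * k
    2c≡n[n-1] = +-cancelʳ-≡ (suc k) (2 * c) (suc k * k)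
      (trans c-identity (trans (*-suc (suc k) k) (+-comm (suc k) (suc k * k))))
    2≤4[p+1] : 2 ≤ 4 * suc p
    2≤4[p+1] = ≤-trans (s≤s (s≤s z≤n)) (*-monoʳ-≤ 4 (s≤s z≤n))
    regroup₁ : ∀ W s → 2 * (W * (2 * s)) ≡ 4 * W * s
    regroup₁ = solve-∀
    regroup₂ : ∀ c s q → 6 * c * s + 4 * q * c ≡ 2 * ((3 * s + q * 2) * c)
    regroup₂ = solve-∀

  isEven : ℕ → Bool
  isEven zero = true
  isEven (suc m) = not (isEven m)

  parityCut : ∀ {n} → Adjacency n
  parityCut i j = isEven (toℕ i) xor isEven (toℕ j)

  parityGraph : ∀ n → TwoColoredGraph n
  parityGraph n = record
    { red = parityCut
    ; blue = λ _ _ → true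
    ; red-sym = λ i j → xor-comm (isEven (toℕ i)) (isEven (toℕ j))
    ; blue-sym = λ _ _ → refl
    }

  xor-triangle : ∀ a b c → a xor b ≡ true → a xor c ≡ true → b xor c ≡ true → ⊥
  xor-triangle true true _ () _ _
  xor-triangle false false _ () _ _
  xor-triangle true false true _ () _
  xor-triangle true false false _ _ ()
  xor-triangle false true true _ _ ()
  xor-triangle false true false _ () _

  parityGraph-K3⁻-free : ∀ n → Free K3⁻ (parityGraph n)
  parityGraph-K3⁻-free n (f , _ , preserves-red , _) =
    xor-triangle (parity zero) (parity (suc zero)) (parity (suc (suc zero)))
      (preserves-red zero (suc zero) refl) (preserves-red zero (suc (suc zero)) refl)
      (preserves-red (suc zero) (suc (suc zero)) refl)
    where
    parity : Fin 3 → Bool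
    parity i = isEven (toℕ (f i))

  evens odds : ℕ → ℕ
  evens n = ∑[ j < n ] ⟦ isEven (toℕ j) ⟧
  odds n = ∑[ j < n ] ⟦ not (isEven (toℕ j)) ⟧

  odds-suc : ∀ n → odds (suc n) ≡ evens n
  odds-suc n = sum-cong-≗ {n} (λ j → cong ⟦_⟧ (not-involutive (isEven (toℕ j))))

  evens-odds-≥ : ∀ n → n ≤ 2 * evens n × n ≤ suc (2 * odds n)
  evens-odds-≥ zero = z≤n , z≤n
  evens-odds-≥ (suc n) with evens-odds-≥ n
  ... | n≤2e , n≤1+2o = ≤-trans (s≤s n≤1+2o) (≤-reflexive (sym (*-suc 2 (odds n))))
                      , s≤s (subst (λ o → n ≤ 2 * o) (sym (odds-suc n)) n≤2e)

  not-xor-not : ∀ a b → not a xor not b ≡ a xor b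
  not-xor-not false b = not-involutive b
  not-xor-not true b = refl

  edgeCount-parityCut-suc : ∀ n → edgeCount (parityCut {suc n}) ≡ evens n + edgeCount (parityCut {n})
  edgeCount-parityCut-suc n = trans (edgeCount-suc {n} parityCut)
    (cong₂ _+_ (odds-suc n) (edgeCount-cong {n} (λ i j → not-xor-not (isEven (toℕ i)) (isEven (toℕ j)))))

  C2-≤-parityCut : ∀ n → n C 2 ≤ 2 * edgeCount (parityCut {n})
  C2-≤-parityCut zero = z≤n
  C2-≤-parityCut (suc n) = begin
    suc n C 2                                           ≡⟨ C2-suc n ⟩
    n + n C 2                                           ≤⟨ +-mono-≤ (proj₁ (evens-odds-≥ n)) (C2-≤-parityCut n) ⟩
    2 * evens n + 2 * edgeCount (parityCut {n})         ≡⟨ *-distribˡ-+ 2 (evens n) (edgeCount (parityCut {n})) ⟨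
    2 * (evens n + edgeCount (parityCut {n}))           ≡⟨ cong (2 *_) (edgeCount-parityCut-suc n) ⟨
    2 * edgeCount (parityCut {suc n})                   ∎
    where open ≤-Reasoning

  parityGraph-edges : ∀ n → edges (parityGraph n) ≡ edgeCount (parityCut {n}) + n C 2
  parityGraph-edges n = cong (edgeCount (parityCut {n}) +_) (edgeCount-complete n)

  parityGraph-edges-≥ : ∀ n → 3 * (n C 2) ≤ edges (parityGraph n) * 2
  parityGraph-edges-≥ n = begin
    3 * (n C 2)                                   ≡⟨ regroup (n C 2) ⟩
    n C 2 + 2 * (n C 2)                           ≤⟨ +-monoˡ-≤ (2 * (n C 2)) (C2-≤-parityCut n) ⟩
    2 * edgeCount (parityCut {n}) + 2 * (n C 2)   ≡⟨ *-distribˡ-+ 2 (edgeCount (parityCut {n})) (n C 2) ⟨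
    2 * (edgeCount (parityCut {n}) + n C 2)       ≡⟨ cong (2 *_) (parityGraph-edges n) ⟨
    2 * edges (parityGraph n)                     ≡⟨ *-comm 2 (edges (parityGraph n)) ⟩
    edges (parityGraph n) * 2                     ∎
    where
    open ≤-Reasoning
    regroup : ∀ c → 3 * c ≡ c + 2 * c
    regroup = solve-∀


open EdgeCounting
open import Data.Nat using (ℕ; _≤_)
open import Data.Rational using (ℚ; 0ℚ; _+_; _-_) renaming (_≤_ to _≤ℚ_; _<_ to _<ℚ_)
open import Data.Product using (Σ-syntax; _×_)

import Data.Nat as ℕ
import Data.Nat.Properties as ℕ
open import Data.Nat.Combinatorics using (_C_)
import Data.Integer as ℤ
import Data.Integer.Properties as ℤ
open import Data.Integer using (+_; +0; +[1+_]; -[1+_])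
open import Data.Rational using (mkℚ; _/_; *<*)
import Data.Rational.Properties as ℚ
open import Data.Rational.Unnormalised using (mkℚᵘ; *≤*)
import Data.Rational.Unnormalised.Properties as ℚᵘ
open import Data.Product using (_,_)
open import Relation.Binary.PropositionalEquality using (subst₂)

fraction-≤ : ∀ {a b c d} .{{_ : ℕ.NonZero b}} .{{_ : ℕ.NonZero d}} →
  a ℕ.* d ≤ c ℕ.* b → + a / b ≤ℚ + c / d
fraction-≤ {a} {ℕ.suc b} {c} {ℕ.suc d} ad≤cb = ℚ.toℚᵘ-cancel-≤
  (ℚᵘ.≤-respˡ-≃ (ℚᵘ.≃-sym (ℚ.toℚᵘ-fromℚᵘ (mkℚᵘ (+ a) b)))
  (ℚᵘ.≤-respʳ-≃ (ℚᵘ.≃-sym (ℚ.toℚᵘ-fromℚᵘ (mkℚᵘ (+ c) d)))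
  (*≤* (subst₂ ℤ._≤_ (ℤ.pos-* a (ℕ.suc d)) (ℤ.pos-* c (ℕ.suc b)) (ℤ.+≤+ ad≤cb)))))

density-≤ : ∀ {n} (G : TwoColoredGraph n) {a b} .{{_ : ℕ.NonZero b}} → 2 ≤ n →
  edges G ℕ.* b ≤ a ℕ.* (n C 2) → density G ≤ℚ + a / b
density-≤ {n} G {a} {b} n≥2 bound with n C 2 | C2-pos n≥2 | bound
... | pairs@(ℕ.suc _) | _ | bound′ = fraction-≤ {edges G} {pairs} {a} {b} bound′

≤-density : ∀ {n} (G : TwoColoredGraph n) {a b} .{{_ : ℕ.NonZero b}} → 2 ≤ n →
  a ℕ.* (n C 2) ≤ edges G ℕ.* b → + a / b ≤ℚ density G
≤-density {n} G {a} {b} n≥2 bound with n C 2 | C2-pos n≥2 | bound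
... | pairs@(ℕ.suc _) | _ | bound′ = fraction-≤ {a} {b} {edges G} {pairs} bound′

p-q≤p : ∀ p {q} → 0ℚ ≤ℚ q → p - q ≤ℚ p
p-q≤p p 0≤q = ℚ.≤-trans (ℚ.+-monoʳ-≤ p (ℚ.neg-antimono-≤ 0≤q)) (ℚ.≤-reflexive (ℚ.+-identityʳ p))

mainTheorem7 : (ε : ℚ) → 0ℚ <ℚ ε →
    Σ[ N ∈ ℕ ] ((n : ℕ) → N ≤ n →
    ((G : TwoColoredGraph n) → Free K3⁻ G → density G ≤ℚ threeHalves + ε)
    × (Σ[ G ∈ TwoColoredGraph n ] (Free K3⁻ G × threeHalves - ε ≤ℚ density G)))
mainTheorem7 ε@(mkℚ +[1+ p ] d _) 0<ε = 2 ℕ.+ d , λ n d+2≤n →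
  upper d+2≤n , (parityGraph n , parityGraph-K3⁻-free n , lower d+2≤n)
  where
  n≥2 : ∀ {n} → 2 ℕ.+ d ≤ n → 2 ≤ n
  n≥2 = ℕ.≤-trans (ℕ.s≤s (ℕ.s≤s ℕ.z≤n))
  upper : ∀ {n} → 2 ℕ.+ d ≤ n → (G : TwoColoredGraph n) → Free K3⁻ G → density G ≤ℚ threeHalves + ε
  upper {n} d+2≤n G free =
    -- threeHalves + ε computes to the fraction (3(d+1) + 2(p+1)) / (2(d+1)).
    density-≤ G {3 ℕ.* ℕ.suc d ℕ.+ ℕ.suc p ℕ.* 2} {2 ℕ.* ℕ.suc d} (n≥2 d+2≤n)
      (threeHalves-slack (edges G) d p d+2≤n (C2-double n) (K3⁻-free-edges-≤ G free))
  lower : ∀ {n} → 2 ℕ.+ d ≤ n → threeHalves - ε ≤ℚ density (parityGraph n)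
  lower {n} d+2≤n = ℚ.≤-trans (p-q≤p threeHalves (ℚ.<⇒≤ 0<ε))
    (≤-density (parityGraph n) {3} {2} (n≥2 d+2≤n) (parityGraph-edges-≥ n))
mainTheorem7 (mkℚ +0 _ _) (*<* (ℤ.+<+ ()))
mainTheorem7 (mkℚ -[1+ _ ] _ _) (*<* ())
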